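{- Let $k,s,p$ be positive integers with $s\geq 1$, $k,p\geq 2$, and let $\epsilon>0$. For families $\mathcal{H}=\mathcal{H}_n\subseteq\binom{[n]}{k}$ with $\nu(\mathcal{H})\leq s$, if $$co_p(\mathcal{H})\geq\left(\frac{s-1}{(k-2)!}+\epsilon\right)n^{k+p-2}+o(n^{k+p-2})$$ as $n\to\infty$, then $$|\mathcal{K}_{sk+1}(\mathcal{H})|\geq\left(\frac{s-1}{(k-2)!}+\epsilon\right)n^{k-2}+o(n^{k-2}).$$
   Context: $\nu(\mathcal{H})$ is the largest number of pairwise disjoint members of $\mathcal{H}$. For $E\subseteq[n]$, $d_{\mathcal{H}}(E)=|\{F\in\mathcal{H}:E\subseteq F\}|$; $co_p(\mathcal{H})=\sum_{E\in\binom{[n]}{k-1}}(d_{\mathcal{H}}(E))^p$; and $\mathcal{K}_d(\mathcal{H})=\{K\in\binom{[n]}{k-1}: d_{\mathcal{H}}(K)\geq d\}$. The asymptotic notation is with $k,s,p,\epsilon$ fixed and $n\to\infty$.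
   Formalization: The constant ε ranges over the positive rationals instead of the positive real numbers. -}

module Defs where

open import Data.Bool using (Bool; true; false; _∧_)
open import Data.Nat using (ℕ; zero; suc; _^_; _≥_; _∸_; _≟_; _≤?_)
open import Data.Nat.Properties using (_!≢0)
open import Data.Nat using (_!)
open import Data.Nat.ListAction using (sum)
open import Data.Fin using (Fin)
open import Data.Fin.Subset using (Subset; inside; outside; _∩_; ∣_∣; _⊆_)
import Data.Fin.Subset as S
open import Data.Fin.Subset.Properties using (_⊆?_)
open import Data.List using (List; []; _∷_; _++_; map; length; filterᵇ)
open import Data.Vec using (_∷_)
import Data.Vec as V
open import Data.Integer using (+_)
open import Data.Rational using (ℚ; _/_; _-_; _*_; _≤_; Positive)
open import Data.Product using (∃; _,_)
import Data.Empty as E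
open import Relation.Nullary using (¬_)
open import Relation.Nullary.Decidable using (⌊_⌋)
open import Relation.Binary.PropositionalEquality using (_≡_; _≢_)

Family : ℕ → Set
Family n = Subset n → Bool

allSubsets : (n : ℕ) → List (Subset n)
allSubsets zero = V.[] ∷ []
allSubsets (suc n) = map (inside ∷_) (allSubsets n) ++ map (outside ∷_) (allSubsets n)

IsKUniform : ∀ {n} → ℕ → Family n → Set
IsKUniform k H = ∀ F → H F ≡ true → ∣ F ∣ ≡ k

NuAtMost : ∀ {n} → ℕ → Family n → Set
NuAtMost {n} s H =
  (F : Fin (suc s) → Subset n) → (∀ i → H (F i) ≡ true) →
  (∀ i j → i ≢ j → F i ∩ F j ≡ S.⊥) → E.⊥

deg : ∀ {n} → Family n → Subset n → ℕ
deg {n} H E = length (filterᵇ (λ F → H F ∧ ⌊ E ⊆? F ⌋) (allSubsets n))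

shadowCands : (n k : ℕ) → List (Subset n)
shadowCands n k = filterᵇ (λ E → ⌊ ∣ E ∣ ≟ k ∸ 1 ⌋) (allSubsets n)

co : ∀ {n} → (k p : ℕ) → Family n → ℕ
co {n} k p H = sum (map (λ E → deg H E ^ p) (shadowCands n k))

Kcount : ∀ {n} → (k d : ℕ) → Family n → ℕ
Kcount {n} k d H = length (filterᵇ (λ K → ⌊ d ≤? deg H K ⌋) (shadowCands n k))

toℚ : ℕ → ℚ
toℚ m = (+ m) / 1

-- f(n) ≥ c · n^e + o(n^e)  as n → ∞, i.e.
-- for every δ > 0 there is N with f(n) ≥ (c - δ) n^e for all n ≥ N.
AsympAtLeast : (ℕ → ℕ) → ℚ → ℕ → Set
AsympAtLeast f c e =
  ∀ (δ : ℚ) → Positive δ → ∃ λ N → ∀ n → n ≥ N → (c - δ) * toℚ (n ^ e) ≤ toℚ (f n)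

coeff : ℕ → ℕ → ℚ
coeff s k = _/_ (+ (s ∸ 1)) ((k ∸ 2) !) {{(k ∸ 2) !≢0}}

-- Every (k-1)-set lies in at most n members of a k-uniform family H, so
-- splitting co_p(H) according to whether d_H(E) ≥ D gives
--   co_p(H) ≤ |K_D(H)| · n^p + n^(k-1) · D^p.
-- For p ≥ 2 the last term is o(n^(k+p-2)), and dividing by n^p turns the
-- asymptotic lower bound on co_p(H) into the same one on |K_D(H)|, for every
-- fixed threshold D.
module Submission where

open import Defs

module Counting where
  open import Algebra.Properties.CommutativeSemigroup using (x∙yz≈y∙xz)
  open import Data.Bool using (T; T?; true; false; _∧_)
  open import Data.Fin.Subset using (Subset; inside; outside; ∣_∣; _⊆_)
  import Data.Fin.Subset as Subset
  open import Data.Fin.Subset.Properties using (_⊆?_; drop-∷-⊆; p⊆q⇒∣p∣≤∣q∣; ⊥⊆; ∣⊥∣≡0)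
  open import Data.List using (List; []; _∷_; _++_; map; length; filter; filterᵇ)
  open import Data.List.Properties using (filter-++; length-++; filter-none)
  open import Data.List.Relation.Binary.Sublist.Propositional using (⊆-refl)
  open import Data.List.Relation.Binary.Sublist.Propositional.Properties using (filter⁺; length-mono-≤)
  open import Data.List.Relation.Unary.All as All using (All; []; _∷_; universal)
  open import Data.List.Relation.Unary.All.Properties using (all-filter)
  open import Data.Nat
  open import Data.Nat.ListAction using (sum)
  open import Data.Nat.Properties
  open import Data.Product using (_×_; _,_)
  open import Data.Vec using ([]; _∷_; here)
  open import Function using (_∘_)
  open import Relation.Binary.PropositionalEquality
  open import Relation.Nullary using (yes; no; does; ¬_)
  open import Relation.Nullary.Decidable using (_×-dec_; ⌊_⌋; toWitness)
  open import Relation.Unary using (Pred; Decidable)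

  module _ {a b p} {A : Set a} {B : Set b} {P : Pred B p} (P? : Decidable P) (f : A → B) where

    length-filter-map : ∀ xs → length (filter P? (map f xs)) ≡ length (filter (P? ∘ f) xs)
    length-filter-map [] = refl
    length-filter-map (x ∷ xs) with does (P? (f x))
    ... | true = cong suc (length-filter-map xs)
    ... | false = length-filter-map xs

  countSubsets : ∀ {n p} {P : Pred (Subset n) p} → Decidable P → ℕ
  countSubsets {n} P? = length (filter P? (allSubsets n))

  module _ {n p} {P : Pred (Subset n) p} (P? : Decidable P) where

    countSubsets-mono : ∀ {q} {Q : Pred (Subset n) q} (Q? : Decidable Q) →
      (∀ {F} → P F → Q F) → countSubsets P? ≤ countSubsets Q?
    countSubsets-mono Q? P⇒Q =
      length-mono-≤ (filter⁺ P? Q? (λ { refl → P⇒Q }) (⊆-refl {x = allSubsets n}))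

    countSubsets-none : (∀ {F} → ¬ P F) → countSubsets P? ≡ 0
    countSubsets-none ¬P = cong length (filter-none P? (universal (λ _ → ¬P) (allSubsets n)))

  module _ {n p} {P : Pred (Subset (suc n)) p} (P? : Decidable P) where

    countSubsets-suc : countSubsets P? ≡ countSubsets (P? ∘ (inside ∷_)) + countSubsets (P? ∘ (outside ∷_))
    countSubsets-suc = begin
      length (filter P? (map (inside ∷_) A ++ map (outside ∷_) A))
        ≡⟨ cong length (filter-++ P? (map (inside ∷_) A) (map (outside ∷_) A)) ⟩
      length (filter P? (map (inside ∷_) A) ++ filter P? (map (outside ∷_) A))
        ≡⟨ length-++ (filter P? (map (inside ∷_) A)) ⟩
      length (filter P? (map (inside ∷_) A)) + length (filter P? (map (outside ∷_) A))
        ≡⟨ cong₂ _+_ (length-filter-map P? (inside ∷_) A) (length-filter-map P? (outside ∷_) A) ⟩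
      countSubsets (P? ∘ (inside ∷_)) + countSubsets (P? ∘ (outside ∷_)) ∎
      where
      open ≡-Reasoning
      A : List (Subset n)
      A = allSubsets n

  Extension : ∀ {n} → ℕ → Subset n → Subset n → Set
  Extension j E F = ∣ F ∣ ≡ j + ∣ E ∣ × E ⊆ F

  extension? : ∀ {n} j (E : Subset n) → Decidable (Extension j E)
  extension? j E F = ∣ F ∣ ≟ j + ∣ E ∣ ×-dec E ⊆? F

  numExtensions : ∀ {n} → ℕ → Subset n → ℕ
  numExtensions j E = countSubsets (extension? j E)

  module _ {n j : ℕ} {E F : Subset n} where

    extension-drop-inside : Extension j (inside ∷ E) (inside ∷ F) → Extension j E F
    extension-drop-inside (size , E⊆F) = suc-injective (trans size (+-suc j ∣ E ∣)) , drop-∷-⊆ E⊆F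

    extension-drop-outside : Extension j (outside ∷ E) (outside ∷ F) → Extension j E F
    extension-drop-outside (size , E⊆F) = size , drop-∷-⊆ E⊆F

    extension-drop-added : Extension (suc j) (outside ∷ E) (inside ∷ F) → Extension j E F
    extension-drop-added (size , E⊆F) = suc-injective size , drop-∷-⊆ E⊆F

    ¬extension-missing : ¬ Extension j (inside ∷ E) (outside ∷ F)
    ¬extension-missing (_ , E⊆F) with () ← E⊆F here

  ¬extension₀-added : ∀ {n} {E F : Subset n} → ¬ Extension 0 (outside ∷ E) (inside ∷ F)
  ¬extension₀-added (size , E⊆F) = 1+n≰n (≤-trans (≤-reflexive size) (p⊆q⇒∣p∣≤∣q∣ (drop-∷-⊆ E⊆F)))

  -- The exact count is (n ∸ ∣ E ∣) C j; the cruder n ^ j is all that is needed.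
  numExtensions≤n^j : ∀ n j (E : Subset n) → numExtensions j E ≤ n ^ j
  numExtensions≤n^j zero zero [] = ≤-refl
  numExtensions≤n^j zero (suc j) [] = z≤n
  numExtensions≤n^j (suc n) j (inside ∷ E) = begin
    numExtensions j (inside ∷ E)
      ≡⟨ countSubsets-suc X? ⟩
    countSubsets (X? ∘ (inside ∷_)) + countSubsets (X? ∘ (outside ∷_))
      ≡⟨ cong (countSubsets (X? ∘ (inside ∷_)) +_) (countSubsets-none (X? ∘ (outside ∷_)) ¬extension-missing) ⟩
    countSubsets (X? ∘ (inside ∷_)) + 0
      ≡⟨ +-identityʳ _ ⟩
    countSubsets (X? ∘ (inside ∷_))
      ≤⟨ countSubsets-mono (X? ∘ (inside ∷_)) (extension? j E) extension-drop-inside ⟩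
    numExtensions j E
      ≤⟨ numExtensions≤n^j n j E ⟩
    n ^ j
      ≤⟨ ^-monoˡ-≤ j (n≤1+n n) ⟩
    suc n ^ j ∎
    where
    open ≤-Reasoning
    X? : Decidable (Extension j (inside ∷ E))
    X? = extension? j (inside ∷ E)
  numExtensions≤n^j (suc n) zero (outside ∷ E) = begin
    numExtensions 0 (outside ∷ E)
      ≡⟨ countSubsets-suc X? ⟩
    countSubsets (X? ∘ (inside ∷_)) + countSubsets (X? ∘ (outside ∷_))
      ≡⟨ cong (_+ countSubsets (X? ∘ (outside ∷_))) (countSubsets-none (X? ∘ (inside ∷_)) ¬extension₀-added) ⟩
    countSubsets (X? ∘ (outside ∷_))
      ≤⟨ countSubsets-mono (X? ∘ (outside ∷_)) (extension? 0 E) extension-drop-outside ⟩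
    numExtensions 0 E
      ≤⟨ numExtensions≤n^j n 0 E ⟩
    1 ∎
    where
    open ≤-Reasoning
    X? : Decidable (Extension 0 (outside ∷ E))
    X? = extension? 0 (outside ∷ E)
  numExtensions≤n^j (suc n) (suc j) (outside ∷ E) = begin
    numExtensions (suc j) (outside ∷ E)
      ≡⟨ countSubsets-suc X? ⟩
    countSubsets (X? ∘ (inside ∷_)) + countSubsets (X? ∘ (outside ∷_))
      ≤⟨ +-mono-≤ (countSubsets-mono (X? ∘ (inside ∷_)) (extension? j E) extension-drop-added)
                  (countSubsets-mono (X? ∘ (outside ∷_)) (extension? (suc j) E) extension-drop-outside) ⟩
    numExtensions j E + numExtensions (suc j) E
      ≤⟨ +-mono-≤ (numExtensions≤n^j n j E) (numExtensions≤n^j n (suc j) E) ⟩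
    suc n * n ^ j
      ≤⟨ *-monoʳ-≤ (suc n) (^-monoˡ-≤ j (n≤1+n n)) ⟩
    suc n ^ suc j ∎
    where
    open ≤-Reasoning
    X? : Decidable (Extension (suc j) (outside ∷ E))
    X? = extension? (suc j) (outside ∷ E)

  deg≤n : ∀ {n k} {H : Family n} → IsKUniform (suc k) H → ∀ {E} → ∣ E ∣ ≡ k → deg H E ≤ n
  deg≤n {n} {k} {H} uniform {E} ∣E∣≡k = begin
    deg H E
      ≤⟨ countSubsets-mono (T? ∘ λ F → H F ∧ ⌊ E ⊆? F ⌋) (extension? 1 E) edge⇒extension ⟩
    numExtensions 1 E
      ≤⟨ numExtensions≤n^j n 1 E ⟩
    n * 1
      ≡⟨ *-identityʳ n ⟩
    n ∎
    where
    open ≤-Reasoning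
    edge⇒extension : ∀ {F} → T (H F ∧ ⌊ E ⊆? F ⌋) → Extension 1 E F
    edge⇒extension {F} F∈H∧E⊆F with H F in F∈H | F∈H∧E⊆F
    ... | true | E⊆F = trans (uniform F F∈H) (cong suc (sym ∣E∣≡k)) , toWitness E⊆F

  length-shadowCands≤n^[k∸1] : ∀ n k → length (shadowCands n k) ≤ n ^ (k ∸ 1)
  length-shadowCands≤n^[k∸1] n k = begin
    length (shadowCands n k)
      ≤⟨ countSubsets-mono (T? ∘ λ E → ⌊ ∣ E ∣ ≟ m ⌋) (extension? m ∅) ofSize⇒extension ⟩
    numExtensions m ∅
      ≤⟨ numExtensions≤n^j n m ∅ ⟩
    n ^ m ∎
    where
    open ≤-Reasoning
    m : ℕ
    m = k ∸ 1
    ∅ : Subset n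
    ∅ = Subset.⊥
    ofSize⇒extension : ∀ {E} → T ⌊ ∣ E ∣ ≟ m ⌋ → Extension m ∅ E
    ofSize⇒extension ∣E∣≡m = trans (toWitness ∣E∣≡m) (sym (trans (cong (m +_) (∣⊥∣≡0 n)) (+-identityʳ m))) , ⊥⊆

  m+[n+o]≤m+n+[d+o] : ∀ m n o d → m + (n + o) ≤ m + n + (d + o)
  m+[n+o]≤m+n+[d+o] m n o d =
    ≤-trans (+-monoʳ-≤ m (+-monoʳ-≤ n (m≤n+m o d))) (≤-reflexive (sym (+-assoc m n (d + o))))

  module _ {a} {A : Set a} (f : A → ℕ) (p D M : ℕ) where
    private
      high low : List A → ℕ
      high xs = length (filterᵇ (λ x → ⌊ D ≤? f x ⌋) xs) * M ^ p
      low xs = length xs * D ^ p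

    sum-^-split : ∀ xs → All (λ x → f x ≤ M) xs →
      sum (map (λ x → f x ^ p) xs) ≤ length (filterᵇ (λ x → ⌊ D ≤? f x ⌋) xs) * M ^ p + length xs * D ^ p
    sum-^-split [] [] = z≤n
    sum-^-split (x ∷ xs) (fx≤M ∷ f≤M) with D ≤? f x
    ... | yes _ = ≤-trans (+-mono-≤ (^-monoˡ-≤ p fx≤M) (sum-^-split xs f≤M))
                          (m+[n+o]≤m+n+[d+o] (M ^ p) (high xs) (low xs) (D ^ p))
    ... | no D≰fx = ≤-trans (+-mono-≤ (^-monoˡ-≤ p (<⇒≤ (≰⇒> D≰fx))) (sum-^-split xs f≤M))
                            (≤-reflexive (x∙yz≈y∙xz +-commutativeSemigroup (D ^ p) (high xs) (low xs)))

  co≤Kcount*n^p+n^[k∸1]*D^p : ∀ {n k} p D {H : Family n} → IsKUniform k H → 1 ≤ k →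
    co k p H ≤ Kcount k D H * n ^ p + n ^ (k ∸ 1) * D ^ p
  co≤Kcount*n^p+n^[k∸1]*D^p {n} {suc k} p D {H} uniform (s≤s z≤n) = begin
    co (suc k) p H
      ≤⟨ sum-^-split (deg H) p D n (shadowCands n (suc k)) degrees≤n ⟩
    Kcount (suc k) D H * n ^ p + length (shadowCands n (suc k)) * D ^ p
      ≤⟨ +-monoʳ-≤ _ (*-monoˡ-≤ (D ^ p) (length-shadowCands≤n^[k∸1] n (suc k))) ⟩
    Kcount (suc k) D H * n ^ p + n ^ k * D ^ p ∎
    where
    open ≤-Reasoning
    degrees≤n : All (λ E → deg H E ≤ n) (shadowCands n (suc k))
    degrees≤n = All.map (deg≤n uniform ∘ toWitness) (all-filter (T? ∘ λ E → ⌊ ∣ E ∣ ≟ k ⌋) (allSubsets n))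

module Asymptotics where
  open import Algebra.Bundles using (CommutativeRing; CommutativeSemigroup)
  open import Algebra.Properties.CommutativeSemigroup using (x∙yz≈y∙xz)
  open import Data.Integer as ℤ using (+_; +[1+_])
  import Data.Integer.Properties as ℤ
  open import Data.Nat as ℕ using (ℕ; suc)
  open import Data.Nat.Coprimality using (1-coprimeTo)
  import Data.Nat.Coprimality as Coprimality
  import Data.Nat.Properties as ℕ
  open import Data.Product using (∃; _,_)
  open import Data.Rational
  open import Data.Rational.Properties
  open import Data.Rational.Solver using (module +-*-Solver)
  import Data.Rational.Unnormalised as ℚᵘ
  import Data.Rational.Unnormalised.Properties as ℚᵘ
  open import Level using (0ℓ)
  open import Relation.Binary.PropositionalEquality

  ℚ-*-commutativeSemigroup : CommutativeSemigroup 0ℓ 0ℓ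
  ℚ-*-commutativeSemigroup = CommutativeRing.*-commutativeSemigroup +-*-commutativeRing

  -- toℚ m normalises (+ m) / 1 through a gcd that does not reduce for a
  -- variable m; the arithmetic of toℚ goes through its normal form instead.
  toℚ≡mkℚ : ∀ m → toℚ m ≡ mkℚ (+ m) 0 (Coprimality.sym (1-coprimeTo m))
  toℚ≡mkℚ m = normalize-coprime (Coprimality.sym (1-coprimeTo m))

  toℚ-+ : ∀ a b → toℚ (a ℕ.+ b) ≡ toℚ a + toℚ b
  toℚ-+ a b rewrite toℚ≡mkℚ a | toℚ≡mkℚ b =
    cong (λ x → x / 1) (sym (cong₂ ℤ._+_ (ℤ.*-identityʳ (+ a)) (ℤ.*-identityʳ (+ b))))

  toℚ-* : ∀ a b → toℚ (a ℕ.* b) ≡ toℚ a * toℚ b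
  toℚ-* a b rewrite toℚ≡mkℚ a | toℚ≡mkℚ b = cong (λ x → x / 1) (ℤ.pos-* a b)

  toℚ-mono-≤ : ∀ {a b} → a ℕ.≤ b → toℚ a ≤ toℚ b
  toℚ-mono-≤ {a} {b} a≤b rewrite toℚ≡mkℚ a | toℚ≡mkℚ b =
    *≤* (subst₂ ℤ._≤_ (sym (ℤ.*-identityʳ (+ a))) (sym (ℤ.*-identityʳ (+ b))) (ℤ.+≤+ a≤b))

  toℚ-nonNeg : ∀ m → NonNegative (toℚ m)
  toℚ-nonNeg m = subst NonNegative (sym (toℚ≡mkℚ m)) _

  toℚ-pos : ∀ m .{{_ : ℕ.NonZero m}} → Positive (toℚ m)
  toℚ-pos (suc m) = subst Positive (sym (toℚ≡mkℚ (suc m))) _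

  archimedean : ∀ h → Positive h → ∃ λ N → 1ℚ ≤ h * toℚ N
  archimedean h@(mkℚ +[1+ a ] b _) _ =
    suc b , toℚᵘ-cancel-≤ (ℚᵘ.≤-respʳ-≃ (ℚᵘ.≃-sym (toℚᵘ-homo-* h (toℚ (suc b)))) 1≤h*[1+b])
    where
    1≤h*[1+b] : toℚᵘ 1ℚ ℚᵘ.≤ toℚᵘ h ℚᵘ.* toℚᵘ (toℚ (suc b))
    1≤h*[1+b] rewrite toℚ≡mkℚ (suc b) =
      ℚᵘ.*≤* (subst₂ ℤ._≤_ (sym (ℤ.*-identityˡ _)) (sym (ℤ.*-identityʳ _))
        (ℤ.+≤+ (ℕ.≤-trans (ℕ.≤-reflexive (ℕ.*-identityʳ (suc b))) (ℕ.m≤n*m (suc b) (suc a)))))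

  Eventually : (ℕ → Set) → Set
  Eventually P = ∃ λ N → ∀ n → n ℕ.≥ N → P n

  eventually-zipWith : ∀ {P Q R : ℕ → Set} → (∀ {n} .{{_ : ℕ.NonZero n}} → P n → Q n → R n) →
    Eventually P → Eventually Q → Eventually R
  eventually-zipWith {R = R} combine (N₁ , P-from) (N₂ , Q-from) = N₁ ℕ.⊔ N₂ ℕ.⊔ 1 , R-from
    where
    R-from : ∀ n → n ℕ.≥ N₁ ℕ.⊔ N₂ ℕ.⊔ 1 → R n
    R-from n n≥N = combine {{ℕ.>-nonZero (ℕ.m⊔n≤o⇒n≤o _ 1 n≥N)}}
      (P-from n (ℕ.m⊔n≤o⇒m≤o N₁ N₂ (ℕ.m⊔n≤o⇒m≤o _ 1 n≥N)))
      (Q-from n (ℕ.m⊔n≤o⇒n≤o N₁ N₂ (ℕ.m⊔n≤o⇒m≤o _ 1 n≥N)))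

  lowerPower-negligible : ∀ C {d e} → d ℕ.< e → ∀ h → Positive h →
    Eventually (λ n → toℚ (n ℕ.^ d ℕ.* C) ≤ h * toℚ (n ℕ.^ e))
  lowerPower-negligible C {d} {e} d<e h h>0 with archimedean h h>0
  ... | N₀ , 1≤h*N₀ = C ℕ.* N₀ ℕ.⊔ 1 , bound
    where
    open ≤-Reasoning
    h≥0 : NonNegative h
    h≥0 = pos⇒nonNeg h {{h>0}}
    C≤h*n : ∀ {n} → C ℕ.* N₀ ℕ.≤ n → toℚ C ≤ h * toℚ n
    C≤h*n {n} CN₀≤n = begin
      toℚ C                 ≡⟨ *-identityʳ (toℚ C) ⟨
      toℚ C * 1ℚ            ≤⟨ *-monoˡ-≤-nonNeg (toℚ C) {{toℚ-nonNeg C}} 1≤h*N₀ ⟩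
      toℚ C * (h * toℚ N₀)  ≡⟨ x∙yz≈y∙xz ℚ-*-commutativeSemigroup (toℚ C) h (toℚ N₀) ⟩
      h * (toℚ C * toℚ N₀)  ≡⟨ cong (h *_) (toℚ-* C N₀) ⟨
      h * toℚ (C ℕ.* N₀)    ≤⟨ *-monoˡ-≤-nonNeg h {{h≥0}} (toℚ-mono-≤ CN₀≤n) ⟩
      h * toℚ n             ∎
    bound : ∀ n → n ℕ.≥ C ℕ.* N₀ ℕ.⊔ 1 → toℚ (n ℕ.^ d ℕ.* C) ≤ h * toℚ (n ℕ.^ e)
    bound n n≥N = begin
      toℚ (n ℕ.^ d ℕ.* C)          ≡⟨ toℚ-* (n ℕ.^ d) C ⟩
      toℚ (n ℕ.^ d) * toℚ C        ≤⟨ *-monoˡ-≤-nonNeg (toℚ (n ℕ.^ d)) {{toℚ-nonNeg (n ℕ.^ d)}} (C≤h*n CN₀≤n) ⟩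
      toℚ (n ℕ.^ d) * (h * toℚ n)  ≡⟨ x∙yz≈y∙xz ℚ-*-commutativeSemigroup (toℚ (n ℕ.^ d)) h (toℚ n) ⟩
      h * (toℚ (n ℕ.^ d) * toℚ n)  ≡⟨ cong (h *_) (toℚ-* (n ℕ.^ d) n) ⟨
      h * toℚ (n ℕ.^ d ℕ.* n)      ≡⟨ cong (λ m → h * toℚ m) (ℕ.*-comm (n ℕ.^ d) n) ⟩
      h * toℚ (n ℕ.^ suc d)        ≤⟨ *-monoˡ-≤-nonNeg h {{h≥0}} (toℚ-mono-≤ (ℕ.^-monoʳ-≤ n {{ℕ.>-nonZero 1≤n}} d<e)) ⟩
      h * toℚ (n ℕ.^ e)            ∎
      where
      CN₀≤n : C ℕ.* N₀ ℕ.≤ n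
      CN₀≤n = ℕ.m⊔n≤o⇒m≤o _ 1 n≥N
      1≤n : 1 ℕ.≤ n
      1≤n = ℕ.m⊔n≤o⇒n≤o _ 1 n≥N

  cancel-error : ∀ c h Y X K → Positive X →
    (c - h) * (Y * X) ≤ K * X + h * (Y * X) → (c - (h + h)) * Y ≤ K
  cancel-error c h Y X K X>0 hyp = *-cancelʳ-≤-pos X {{X>0}} (begin
    (c - (h + h)) * Y * X
      ≡⟨ solve 4 (λ c h Y X → (c :- (h :+ h)) :* Y :* X := (c :- h) :* (Y :* X) :- h :* (Y :* X)) refl c h Y X ⟩
    (c - h) * (Y * X) - h * (Y * X)
      ≤⟨ +-monoˡ-≤ (- (h * (Y * X))) hyp ⟩
    K * X + h * (Y * X) - h * (Y * X)
      ≡⟨ solve 2 (λ KX hYX → KX :+ hYX :- hYX := KX) refl (K * X) (h * (Y * X)) ⟩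
    K * X ∎)
    where
    open ≤-Reasoning
    open +-*-Solver

  -- Half of δ is spent on the hypothesis about f, the other half on the error term.
  asympAtLeast-÷n^p : ∀ {f g : ℕ → ℕ} {c} e p {d} C → d ℕ.< e ℕ.+ p →
    (∀ n → f n ℕ.≤ g n ℕ.* n ℕ.^ p ℕ.+ n ℕ.^ d ℕ.* C) →
    AsympAtLeast f c (e ℕ.+ p) → AsympAtLeast g c e
  asympAtLeast-÷n^p {f} {g} {c} e p {d} C d<e+p f≤ f≳ δ δ>0 =
    subst (λ δ → Eventually (λ n → (c - δ) * toℚ (n ℕ.^ e) ≤ toℚ (g n))) (sym δ≡h+h)
      (eventually-zipWith g≥ (f≳ h h>0) (lowerPower-negligible C d<e+p h h>0))
    where
    h : ℚ
    h = δ * ½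
    h>0 : Positive h
    h>0 = pos*pos⇒pos δ {{δ>0}} ½
    δ≡h+h : δ ≡ h + h
    δ≡h+h = trans (sym (*-identityʳ δ)) (*-distribˡ-+ δ ½ ½)
    g≥ : ∀ {n} .{{_ : ℕ.NonZero n}} → (c - h) * toℚ (n ℕ.^ (e ℕ.+ p)) ≤ toℚ (f n) →
      toℚ (n ℕ.^ d ℕ.* C) ≤ h * toℚ (n ℕ.^ (e ℕ.+ p)) → (c - (h + h)) * toℚ (n ℕ.^ e) ≤ toℚ (g n)
    g≥ {n} f≥ error≤ = cancel-error c h nᵉ nᵖ (toℚ (g n)) (toℚ-pos (n ℕ.^ p) {{ℕ.m^n≢0 n p}}) (begin
      (c - h) * (nᵉ * nᵖ)                         ≡⟨ cong ((c - h) *_) n^[e+p] ⟨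
      (c - h) * toℚ (n ℕ.^ (e ℕ.+ p))             ≤⟨ f≥ ⟩
      toℚ (f n)                                   ≤⟨ toℚ-mono-≤ (f≤ n) ⟩
      toℚ (g n ℕ.* n ℕ.^ p ℕ.+ n ℕ.^ d ℕ.* C)     ≡⟨ toℚ-+ (g n ℕ.* n ℕ.^ p) _ ⟩
      toℚ (g n ℕ.* n ℕ.^ p) + toℚ (n ℕ.^ d ℕ.* C) ≡⟨ cong (_+ _) (toℚ-* (g n) (n ℕ.^ p)) ⟩
      toℚ (g n) * nᵖ + toℚ (n ℕ.^ d ℕ.* C)        ≤⟨ +-monoʳ-≤ (toℚ (g n) * nᵖ) error≤ ⟩
      toℚ (g n) * nᵖ + h * toℚ (n ℕ.^ (e ℕ.+ p))  ≡⟨ cong (λ x → toℚ (g n) * nᵖ + h * x) n^[e+p] ⟩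
      toℚ (g n) * nᵖ + h * (nᵉ * nᵖ)              ∎)
      where
      open ≤-Reasoning
      nᵉ nᵖ : ℚ
      nᵉ = toℚ (n ℕ.^ e)
      nᵖ = toℚ (n ℕ.^ p)
      n^[e+p] : toℚ (n ℕ.^ (e ℕ.+ p)) ≡ nᵉ * nᵖ
      n^[e+p] = trans (cong toℚ (ℕ.^-distribˡ-+-* n e p)) (toℚ-* (n ℕ.^ e) (n ℕ.^ p))

open import Data.Nat using (ℕ; suc; s≤s; z≤n; _≤_; _<_; _+_; _*_; _^_; _∸_)
open import Data.Nat.Properties using (≤-trans; ≤-reflexive; +-comm; +-monoʳ-≤)
open import Data.Rational using (ℚ; Positive)
import Data.Rational as Q
open Counting using (co≤Kcount*n^p+n^[k∸1]*D^p)
open Asymptotics using (asympAtLeast-÷n^p)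

lemma2p5 : (k s p : ℕ) → 1 ≤ s → 2 ≤ k → 2 ≤ p →
    (ε : ℚ) → Positive ε →
    (H : (n : ℕ) → Family n) →
    (∀ n → IsKUniform k (H n)) →
    (∀ n → NuAtMost s (H n)) →
    AsympAtLeast (λ n → co k p (H n)) (coeff s k Q.+ ε) (k + p ∸ 2) →
    AsympAtLeast (λ n → Kcount k (s * k + 1) (H n)) (coeff s k Q.+ ε) (k ∸ 2)
lemma2p5 k@(suc (suc e)) s p _ (s≤s (s≤s z≤n)) 2≤p ε _ H uniform _ =
  asympAtLeast-÷n^p {g = λ n → Kcount k D (H n)} {c = coeff s k Q.+ ε} e p (D ^ p) suc[e]<e+p
    (λ n → co≤Kcount*n^p+n^[k∸1]*D^p p D (uniform n) (s≤s z≤n))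
  where
  D : ℕ
  D = s * k + 1
  suc[e]<e+p : suc e < e + p
  suc[e]<e+p = ≤-trans (≤-reflexive (+-comm 2 e)) (+-monoʳ-≤ e 2≤p)
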